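{- There is a $\frac12$-gadget-reduction from $\mathsf{2\text{ - }NLin}(\mathbb{Z}_3)$ to $2$-to-$1$ Label Cover.
   Context: $\mathsf{2\text{ - }NLin}(\mathbb{Z}_3)$ is the CSP with label set $\mathbb{Z}_3$ and constraints $v_i - v_j\neq a\pmod 3$, $a\in\mathbb{Z}_3$. An instance of $2$-to-$1$ Label Cover is a bipartite graph $G=(U\cup V,E)$ with weighted edges, vertices of $U$ labeled from a set of size $K$, vertices of $V$ labeled from a set of size $2K$, and for each edge $e$ a $2$-to-$1$ map $\pi_e$ from the $V$-labels to the $U$-labels; a labeling $F$ satisfies $e=(u,v)$ iff $\pi_e(F(v))=F(u)$. CSP instances have constraints with nonnegative weights summing to $1$. A $\gamma$-gadget-reduction from $\mathsf{CSP}_1$ to $\mathsf{CSP}_2$ (for $0<\gamma<1$) maps each $\mathsf{CSP}_1$ constraint to a weighted set of $\mathsf{CSP}_2$ constraints over the variables of that constraint together with new auxiliary variables (not shared between different $\mathsf{CSP}_1$ constraints), such that: every assignment satisfying the $\mathsf{CSP}_1$ constraint can be extended to the auxiliary variables so as to satisfy all the $\mathsf{CSP}_2$ constraints; and for every assignment not satisfying the $\mathsf{CSP}_1$ constraint, the best extension to the auxiliary variables satisfies exactly a $\gamma$ fraction (by weight) of the $\mathsf{CSP}_2$ constraints. -}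

module Defs where

open import Data.Bool using (if_then_else_)
open import Data.Nat as ℕ using (ℕ)
open import Data.Nat.DivMod using (_mod_)
open import Data.Fin using (Fin; toℕ; zero; suc)
open import Data.Fin.Properties using (_≟_)
open import Data.List using (List; filter; length; foldr; allFin)
open import Data.List.Relation.Unary.All using (All)
open import Data.Rational using (ℚ; 0ℚ; 1ℚ; _+_; _≤_)
open import Data.Sum using (_⊎_; inj₁; inj₂)
open import Data.Product using (Σ; _×_)
open import Relation.Binary.PropositionalEquality using (_≡_)
open import Relation.Nullary using (¬_; does)

Z3 : Set
Z3 = Fin 3

_-₃_ : Z3 → Z3 → Z3
x -₃ y = ((3 ℕ.+ toℕ x) ℕ.∸ toℕ y) mod 3

NLinSat : (a x y : Z3) → Set
NLinSat a x y = ¬ (x -₃ y ≡ a)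

-- 2-to-1 Label Cover with K = 3 : U-labels Fin 3 (= Z_3), V-labels Fin 6

ULabel : Set
ULabel = Fin 3

VLabel : Set
VLabel = Fin 6

IsTwoToOne : (VLabel → ULabel) → Set
IsTwoToOne π = ∀ u → length (filter (λ v → π v ≟ u) (allFin 6)) ≡ 2

-- U-side endpoint is either
-- one of the two original variables (inj₁ zero = v_i, inj₁ (suc zero) = v_j)
-- or an auxiliary U-vertex; the V-side endpoint is an auxiliary V-vertex.
record Edge (nU nV : ℕ) : Set where
  field
    uEnd     : Fin 2 ⊎ Fin nU
    vEnd     : Fin nV
    π        : VLabel → ULabel
    twoToOne : IsTwoToOne π
    weight   : ℚ
    weight≥0 : 0ℚ ≤ weight

record LCGadget : Set where
  field
    nU    : ℕ
    nV    : ℕ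
    edges : List (Edge nU nV)

open Edge
open LCGadget

totalWeight : LCGadget → ℚ
totalWeight g = foldr (λ e acc → weight e + acc) 0ℚ (edges g)

uLabel : ∀ {nU} → Z3 → Z3 → (Fin nU → ULabel) → Fin 2 ⊎ Fin nU → ULabel
uLabel x y fU (inj₁ zero)       = x
uLabel x y fU (inj₁ (suc zero)) = y
uLabel x y fU (inj₂ w)          = fU w

EdgeSat : ∀ {nU nV} → Z3 → Z3 → (Fin nU → ULabel) → (Fin nV → VLabel)
          → Edge nU nV → Set
EdgeSat x y fU fV e = π e (fV (vEnd e)) ≡ uLabel x y fU (uEnd e)

satWeight : (g : LCGadget) → Z3 → Z3 → (Fin (nU g) → ULabel)
            → (Fin (nV g) → VLabel) → ℚ
satWeight g x y fU fV =
  foldr (λ e acc → if does (π e (fV (vEnd e)) ≟ uLabel x y fU (uEnd e))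
                   then weight e + acc else acc)
        0ℚ (edges g)

Complete : Z3 → LCGadget → Set
Complete a g = ∀ x y → NLinSat a x y →
  Σ (Fin (nU g) → ULabel) λ fU → Σ (Fin (nV g) → VLabel) λ fV →
    All (EdgeSat x y fU fV) (edges g)

Sound : ℚ → Z3 → LCGadget → Set
Sound γ a g = ∀ x y → ¬ NLinSat a x y →
  (Σ (Fin (nU g) → ULabel) λ fU → Σ (Fin (nV g) → VLabel) λ fV →
      satWeight g x y fU fV ≡ γ)
  × (∀ fU fV → satWeight g x y fU fV ≤ γ)

GadgetReduction : ℚ → Set
GadgetReduction γ = (a : Z3) → Σ LCGadget λ g →
  (totalWeight g ≡ 1ℚ) × Complete a g × Sound γ a g

-- One auxiliary V-vertex w is joined to v_i and v_j by edges of weight ½.  A label of w is a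
-- pair (x , b) ∈ Z₃ × Z₂; the edge to v_i reads off x and the edge to v_j reads off
-- x − (a − (1 + b)).  Both maps are 2-to-1, and the pairs they read off are exactly those with
-- v_i − v_j = a − (1 + b) ≠ a, i.e. the satisfying assignments.  Hence a satisfying assignment
-- satisfies both edges, while for a violating one at most one edge holds, and the edge to v_i
-- always can.
module Submission where

open import Defs
open import Data.Nat as ℕ using (ℕ)
open import Data.Fin using (Fin; suc; combine; remQuot)
open import Data.Fin.Patterns using (0F; 1F; 2F)
open import Data.Fin.Properties using (_≟_; 0≢1+n; remQuot-combine)
open import Data.List using ([]; _∷_)
open import Data.List.Relation.Unary.All using ([]; _∷_)
open import Data.Sum using (inj₁)
open import Data.Product using (Σ; _×_; _,_; proj₁; proj₂)
open import Data.Rational using (½; 0ℚ; _≤_)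
open import Data.Rational.Properties using (≤-reflexive; +-identityʳ; nonNegative⁻¹)
open import Data.Empty using (⊥; ⊥-elim)
open import Relation.Binary.PropositionalEquality using (_≡_; _≢_; refl; sym; trans; cong)
open import Relation.Binary.PropositionalEquality.Properties using (module ≡-Reasoning)
open import Relation.Nullary using (yes; no)
open import Relation.Nullary.Decidable using (decidable-stable)

-₃-involutive : ∀ x c → x -₃ (x -₃ c) ≡ c
-₃-involutive 0F 0F = refl
-₃-involutive 0F 1F = refl
-₃-involutive 0F 2F = refl
-₃-involutive 1F 0F = refl
-₃-involutive 1F 1F = refl
-₃-involutive 1F 2F = refl
-₃-involutive 2F 0F = refl
-₃-involutive 2F 1F = refl
-₃-involutive 2F 2F = refl

x-₃0≡x : ∀ x → x -₃ 0F ≡ x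
x-₃0≡x 0F = refl
x-₃0≡x 1F = refl
x-₃0≡x 2F = refl

x-₃y≡0⇒x≡y : ∀ x y → x -₃ y ≡ 0F → x ≡ y
x-₃y≡0⇒x≡y x y x-y≡0 = begin
  x                ≡⟨ sym (x-₃0≡x x) ⟩
  x -₃ 0F          ≡⟨ cong (x -₃_) (sym x-y≡0) ⟩
  x -₃ (x -₃ y)    ≡⟨ -₃-involutive x y ⟩
  y                ∎
  where open ≡-Reasoning

x-₃y≡x⇒y≡0 : ∀ x y → x -₃ y ≡ x → y ≡ 0F
x-₃y≡x⇒y≡0 x y x-y≡x = begin
  y                ≡⟨ sym (-₃-involutive x y) ⟩
  x -₃ (x -₃ y)    ≡⟨ cong (x -₃_) (trans x-y≡x (sym (x-₃0≡x x))) ⟩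
  x -₃ (x -₃ 0F)   ≡⟨ -₃-involutive x 0F ⟩
  0F               ∎
  where open ≡-Reasoning

≢0⇒suc : ∀ {n} (d : Fin (ℕ.suc n)) → d ≢ 0F → Σ (Fin n) λ b → suc b ≡ d
≢0⇒suc 0F      d≢0 = ⊥-elim (d≢0 refl)
≢0⇒suc (suc b) _   = b , refl

½≥0 : 0ℚ ≤ ½
½≥0 = nonNegative⁻¹ ½

module SingleVertexGadget (p q : VLabel → ULabel) (p-2to1 : IsTwoToOne p) (q-2to1 : IsTwoToOne q) where

  gadget : LCGadget
  gadget = record
    { nU    = 0
    ; nV    = 1
    ; edges = record { uEnd = inj₁ 0F ; vEnd = 0F ; π = p ; twoToOne = p-2to1 ; weight = ½ ; weight≥0 = ½≥0 }
            ∷ record { uEnd = inj₁ 1F ; vEnd = 0F ; π = q ; twoToOne = q-2to1 ; weight = ½ ; weight≥0 = ½≥0 }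
            ∷ []
    }

  noAux : Fin 0 → ULabel
  noAux ()

  complete : ∀ a → (∀ x y → NLinSat a x y → Σ VLabel λ l → p l ≡ x × q l ≡ y) → Complete a gadget
  complete a realise x y sat with realise x y sat
  ... | l , pl≡x , ql≡y = noAux , (λ _ → l) , pl≡x ∷ ql≡y ∷ []

  sound : ∀ a → (∀ l → NLinSat a (p l) (q l)) → (∀ x → Σ VLabel λ l → p l ≡ x) → Sound ½ a gadget
  sound a onlySat p-onto x y unsat = (noAux , (λ _ → proj₁ (p-onto x)) , attained) , bounded
    where
    x-y≡a : x -₃ y ≡ a
    x-y≡a = decidable-stable (x -₃ y ≟ a) unsat

    notBoth : ∀ l → p l ≡ x → q l ≡ y → ⊥
    notBoth l refl refl = onlySat l x-y≡a

    attained : satWeight gadget x y noAux (λ _ → proj₁ (p-onto x)) ≡ ½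
    attained with p (proj₁ (p-onto x)) ≟ x | q (proj₁ (p-onto x)) ≟ y
    ... | yes pl≡x | yes ql≡y = ⊥-elim (notBoth _ pl≡x ql≡y)
    ... | yes _    | no _     = +-identityʳ ½
    ... | no pl≢x  | _        = ⊥-elim (pl≢x (proj₂ (p-onto x)))

    bounded : ∀ fU fV → satWeight gadget x y fU fV ≤ ½
    bounded fU fV with p (fV 0F) ≟ x | q (fV 0F) ≟ y
    ... | yes pl≡x | yes ql≡y = ⊥-elim (notBoth _ pl≡x ql≡y)
    ... | yes _    | no _     = ≤-reflexive (+-identityʳ ½)
    ... | no _     | yes _    = ≤-reflexive (+-identityʳ ½)
    ... | no _     | no _     = ½≥0

-- A V-label l = 3b + x encodes the pair (b , x) ∈ Z₂ × Z₃.
label : Fin 2 → Z3 → VLabel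
label = combine

bit : VLabel → Fin 2
bit l = proj₁ (remQuot {2} 3 l)

πᵢ : VLabel → ULabel
πᵢ l = proj₂ (remQuot {2} 3 l)

πⱼ : Z3 → VLabel → ULabel
πⱼ a l = πᵢ l -₃ (a -₃ suc (bit l))

πᵢ-2to1 : IsTwoToOne πᵢ
πᵢ-2to1 0F = refl
πᵢ-2to1 1F = refl
πᵢ-2to1 2F = refl

πⱼ-2to1 : ∀ a → IsTwoToOne (πⱼ a)
πⱼ-2to1 0F 0F = refl
πⱼ-2to1 0F 1F = refl
πⱼ-2to1 0F 2F = refl
πⱼ-2to1 1F 0F = refl
πⱼ-2to1 1F 1F = refl
πⱼ-2to1 1F 2F = refl
πⱼ-2to1 2F 0F = refl
πⱼ-2to1 2F 1F = refl
πⱼ-2to1 2F 2F = refl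

πᵢ-label : ∀ b x → πᵢ (label b x) ≡ x
πᵢ-label b x = cong proj₂ (remQuot-combine {2} {3} b x)

πⱼ-label : ∀ a b x → πⱼ a (label b x) ≡ x -₃ (a -₃ suc b)
πⱼ-label a b x = cong (λ (b , x) → x -₃ (a -₃ suc b)) (remQuot-combine {2} {3} b x)

πᵢ-surjective : ∀ x → Σ VLabel λ l → πᵢ l ≡ x
πᵢ-surjective x = label 0F x , πᵢ-label 0F x

πᵢ-πⱼ-sat : ∀ a l → NLinSat a (πᵢ l) (πⱼ a l)
πᵢ-πⱼ-sat a l x-y≡a = 0≢1+n (sym (x-₃y≡x⇒y≡0 a (suc (bit l)) offset≡a))
  where
  offset≡a : a -₃ suc (bit l) ≡ a
  offset≡a = trans (sym (-₃-involutive (πᵢ l) (a -₃ suc (bit l)))) x-y≡a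

πᵢ-πⱼ-realise : ∀ a x y → NLinSat a x y → Σ VLabel λ l → πᵢ l ≡ x × πⱼ a l ≡ y
πᵢ-πⱼ-realise a x y x-y≢a = label b x , πᵢ-label b x , πⱼ≡y
  where
  d≢0 : a -₃ (x -₃ y) ≢ 0F
  d≢0 d≡0 = x-y≢a (sym (x-₃y≡0⇒x≡y a (x -₃ y) d≡0))

  b : Fin 2
  b = proj₁ (≢0⇒suc _ d≢0)

  πⱼ≡y : πⱼ a (label b x) ≡ y
  πⱼ≡y = begin
    πⱼ a (label b x)            ≡⟨ πⱼ-label a b x ⟩
    x -₃ (a -₃ suc b)           ≡⟨ cong (λ d → x -₃ (a -₃ d)) (proj₂ (≢0⇒suc _ d≢0)) ⟩
    x -₃ (a -₃ (a -₃ (x -₃ y))) ≡⟨ cong (x -₃_) (-₃-involutive a (x -₃ y)) ⟩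
    x -₃ (x -₃ y)               ≡⟨ -₃-involutive x y ⟩
    y                           ∎
    where open ≡-Reasoning

lemma3p2 : GadgetReduction ½
lemma3p2 a = gadget , refl , complete a (πᵢ-πⱼ-realise a) , sound a (πᵢ-πⱼ-sat a) πᵢ-surjective
  where open SingleVertexGadget πᵢ (πⱼ a) πᵢ-2to1 (πⱼ-2to1 a)
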